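{- Let $a,b$ be positive square-free integers with $\gcd(a,b) \leq 2$, let $f(x_0,y_1,y_2,y_3) = x_0^2 - a y_1^2 - b y_2^2 - ab y_3^2$, and let $2^{\nu}$ be the highest power of $2$ dividing $2^4 a^2 b^2$. Suppose $d \in \mathbb{Z}$ with $d \not\equiv 0 \pmod 4$. Then $f$ properly represents $d \bmod 2^{\nu}$, i.e., there exist integers $r_0,r_1,r_2,r_3$ with $\gcd(r_0,r_1,r_2,r_3) = 1$ and $f(r_0,r_1,r_2,r_3) \equiv d \pmod{2^{\nu}}$. -}

module Defs where

open import Data.Nat as ℕ using (ℕ; _^_)
open import Data.Nat.Divisibility as ℕD using ()
open import Data.Nat.GCD using (gcd)
open import Data.Nat.Primality using (Prime)
open import Data.Integer as ℤ using (ℤ; +_; _-_; _*_; ∣_∣)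
open import Data.Integer.Divisibility as ℤD using ()
open import Relation.Nullary using (¬_)
open import Relation.Binary.PropositionalEquality using (_≡_)

SquareFree : ℕ → Set
SquareFree n = ∀ p → Prime p → ¬ (p ℕ.* p ℕD.∣ n)

f : ℤ → ℤ → ℤ → ℤ → ℤ → ℤ → ℤ
f a b x0 y1 y2 y3 =
  x0 * x0 - a * (y1 * y1) - b * (y2 * y2) - (a * b) * (y3 * y3)

infix 4 _≡_[mod_]
_≡_[mod_] : ℤ → ℤ → ℤ → Set
x ≡ y [mod m ] = m ℤD.∣ (x - y)

gcd4 : ℤ → ℤ → ℤ → ℤ → ℕ
gcd4 r0 r1 r2 r3 = gcd (gcd (gcd ∣ r0 ∣ ∣ r1 ∣) ∣ r2 ∣) ∣ r3 ∣

ExactTwoPower : ℕ → ℕ → Set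
ExactTwoPower ν n = (2 ^ ν ℕD.∣ n) × ¬ (2 ^ ℕ.suc ν ℕD.∣ n)
  where open import Data.Product using (_×_)

module Submission where

-- Since 4 ∤ a and 4 ∤ b, the exponent ν is at most 8, so it suffices to represent d modulo 2⁸.
-- One coordinate carries an odd 2-adic square root: if c is odd and r ≡ c (mod 8), then
-- c y² ≡ r (mod 2ᵏ) has an odd solution y for every k (Hensel lifting), and the same holds
-- for c ≡ 2 (mod 4), r ≡ c (mod 16) after halving. The other three coordinates take values
-- in {0, 1, 2}, chosen by a finite search over a, b, d modulo 16 so that the value r left for
-- the reserved coordinate meets this condition and one of them is 1 or 2. The gcd of the four
-- coordinates then divides both an odd number and 2, so it is 1.

open import Defs
open import Data.Empty using (⊥-elim)
open import Data.Fin using (Fin; zero; suc; punchIn; toℕ; fromℕ<)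
open import Data.Fin.Patterns using (0F; 1F; 2F; 3F)
open import Data.Fin.Properties using (any?; all?; toℕ-fromℕ<)
open import Data.Integer as ℤ using (ℤ; +_; _+_; _-_; _*_; -_; _%ℕ_; _/ℕ_)
open import Data.Integer.DivMod using (n%ℕd<d; a≡a%ℕn+[a/ℕn]*n)
import Data.Integer.Divisibility.Signed as Signed
import Data.Integer.Properties as ℤP
open import Algebra.Properties.CommutativeMonoid.Sum ℤP.+-0-commutativeMonoid
  using (sum; sum-remove; sum-cong-≗)
open import Data.Integer.Tactic.RingSolver using (solve-∀; solve)
open import Data.List using ([]; _∷_)
open import Data.Nat as ℕ using (ℕ; zero; suc; _^_; _≤_)
import Data.Nat.Divisibility as ℕ
open import Data.Nat.GCD using (gcd; gcd[m,n]∣m; gcd[m,n]∣n)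
open import Data.Nat.Primality using (irreducible[2]; prime[2]; euclidsLemma)
import Data.Nat.Properties as ℕP
import Data.Nat.Tactic.RingSolver as ℕ
open import Data.Product using (_×_; _,_; ∃-syntax)
open import Data.Sum using (_⊎_; inj₁; inj₂; [_,_]′)
open import Data.Vec.Functional using (Vector; insertAt; removeAt)
open import Data.Vec.Functional.Properties using (insertAt-lookup; insertAt-punchIn)
open import Function using (_∘_)
open import Relation.Binary.PropositionalEquality
open import Relation.Nullary using (¬_; Dec; ¬?; yes; no)
open import Relation.Nullary.Decidable using (map′; _×-dec_; _⊎-dec_; _→-dec_; toWitness)

-- Defs' congruence unfolds to divisibility of natural numbers ∣ x - y ∣, from which x, y, m
-- cannot be inferred; this witness form is a record, so they can.
infix 4 _≡_⟨mod_⟩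
record _≡_⟨mod_⟩ (x y m : ℤ) : Set where
  constructor witness
  field
    quotient : ℤ
    equation : x ≡ y + m * quotient

⟨mod⟩⇒[mod] : ∀ {x y m} → x ≡ y ⟨mod m ⟩ → x ≡ y [mod m ]
⟨mod⟩⇒[mod] {y = y} {m} (witness k refl) =
  Signed.∣⇒∣ᵤ {m} {y + m * k - y} (Signed.divides k (solve (y ∷ m ∷ k ∷ [])))

[mod]⇒⟨mod⟩ : ∀ x y m → x ≡ y [mod m ] → x ≡ y ⟨mod m ⟩
[mod]⇒⟨mod⟩ x y m x≡y with Signed.∣ᵤ⇒∣ {m} {x - y} x≡y
... | Signed.divides k x-y≡km = witness k (begin
  x           ≡⟨ solve (x ∷ y ∷ []) ⟩
  y + (x - y) ≡⟨ cong (_+_ y) x-y≡km ⟩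
  y + k * m   ≡⟨ cong (_+_ y) (ℤP.*-comm k m) ⟩
  y + m * k   ∎)
  where open ≡-Reasoning

infix 4 _≡?_⟨mod_⟩
_≡?_⟨mod_⟩ : ∀ x y m → Dec (x ≡ y ⟨mod m ⟩)
x ≡? y ⟨mod m ⟩ = map′ ([mod]⇒⟨mod⟩ x y m) ⟨mod⟩⇒[mod] (ℤ.∣ m ∣ ℕ.∣? ℤ.∣ x - y ∣)

mod-refl : ∀ {x m} → x ≡ x ⟨mod m ⟩
mod-refl {x} {m} = witness (+ 0) (solve (x ∷ m ∷ []))

mod-reflexive : ∀ {x y m} → x ≡ y → x ≡ y ⟨mod m ⟩
mod-reflexive refl = mod-refl

mod-sym : ∀ {x y m} → x ≡ y ⟨mod m ⟩ → y ≡ x ⟨mod m ⟩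
mod-sym {y = y} {m} (witness k refl) = witness (- k) (solve (y ∷ m ∷ k ∷ []))

mod-trans : ∀ {x y z m} → x ≡ y ⟨mod m ⟩ → y ≡ z ⟨mod m ⟩ → x ≡ z ⟨mod m ⟩
mod-trans {z = z} {m} (witness k refl) (witness l refl) =
  witness (l + k) (solve (z ∷ m ∷ k ∷ l ∷ []))

mod-+ : ∀ {x y u v m} → x ≡ y ⟨mod m ⟩ → u ≡ v ⟨mod m ⟩ → x + u ≡ y + v ⟨mod m ⟩
mod-+ {y = y} {v = v} {m} (witness k refl) (witness l refl) =
  witness (k + l) (solve (y ∷ v ∷ m ∷ k ∷ l ∷ []))

mod-neg : ∀ {x y m} → x ≡ y ⟨mod m ⟩ → - x ≡ - y ⟨mod m ⟩
mod-neg {y = y} {m} (witness k refl) = witness (- k) (solve (y ∷ m ∷ k ∷ []))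

mod-* : ∀ {x y u v m} → x ≡ y ⟨mod m ⟩ → u ≡ v ⟨mod m ⟩ → x * u ≡ y * v ⟨mod m ⟩
mod-* {y = y} {v = v} {m} (witness k refl) (witness l refl) =
  witness (k * v + y * l + m * k * l) (solve (y ∷ v ∷ m ∷ k ∷ l ∷ []))

mod-scale : ∀ k {x y m} → x ≡ y ⟨mod m ⟩ → k * x ≡ k * y ⟨mod k * m ⟩
mod-scale k {y = y} {m} (witness l refl) = witness l (solve (k ∷ y ∷ m ∷ l ∷ []))

mod-weaken : ∀ {x y m n} → n Signed.∣ m → x ≡ y ⟨mod m ⟩ → x ≡ y ⟨mod n ⟩
mod-weaken {y = y} {n = n} (Signed.divides q refl) (witness k refl) =
  witness (q * k) (solve (y ∷ n ∷ q ∷ k ∷ []))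

mod-resp : ∀ {m M x x′ y y′} → m Signed.∣ M → x ≡ x′ ⟨mod M ⟩ → y ≡ y′ ⟨mod M ⟩ →
           x′ ≡ y′ ⟨mod m ⟩ → x ≡ y ⟨mod m ⟩
mod-resp m∣M x≡x′ y≡y′ x′≡y′ =
  mod-trans (mod-weaken m∣M x≡x′) (mod-trans x′≡y′ (mod-sym (mod-weaken m∣M y≡y′)))

residue : ∀ x n .{{_ : ℕ.NonZero n}} → ∃[ r ] x ≡ + toℕ {n} r ⟨mod + n ⟩
residue x n = fromℕ< (n%ℕd<d x n) , witness (x /ℕ n) (begin
  x                                 ≡⟨ a≡a%ℕn+[a/ℕn]*n x n ⟩
  + (x %ℕ n) + (x /ℕ n) * + n        ≡⟨ cong₂ _+_ (cong +_ (sym (toℕ-fromℕ< _)))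
                                                  (ℤP.*-comm (x /ℕ n) (+ n)) ⟩
  + toℕ (fromℕ< _) + + n * (x /ℕ n) ∎)
  where open ≡-Reasoning

-- Hensel step: if c y² = r - 2ⁿ⁺³ m, replacing y by y + 2ⁿ⁺² m adds 2ⁿ⁺³ m c y modulo 2ⁿ⁺⁴,
-- which cancels the error because c y is odd.
odd-square-lift : ∀ n {c r} → c ≡ + 1 ⟨mod + 2 ⟩ → r ≡ c ⟨mod + 8 ⟩ →
                  ∃[ y ] y ≡ + 1 ⟨mod + 2 ⟩ × c * (y * y) ≡ r ⟨mod + 8 * (+ 2) ℤ.^ n ⟩
odd-square-lift zero {c} c-odd r≡c =
  + 1 , mod-refl , mod-trans (mod-reflexive (ℤP.*-identityʳ c)) (mod-sym r≡c)
odd-square-lift (suc n) c-odd r≡c with odd-square-lift n c-odd r≡c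
... | y , y-odd , cy²≡r with c-odd | y-odd | mod-sym cy²≡r
...   | witness γ refl | witness κ refl | witness m refl =
  y + + 4 * P * m ,
  witness (κ + + 2 * P * m) (still-odd κ m P) ,
  witness (m * (γ + κ + + 2 * γ * κ) + P * m * m * (+ 1 + + 2 * γ)) (corrected γ κ m P)
  where
  P = (+ 2) ℤ.^ n
  still-odd : ∀ κ m P → (+ 1 + + 2 * κ) + + 4 * P * m ≡ + 1 + + 2 * (κ + + 2 * P * m)
  still-odd = solve-∀
  corrected : ∀ γ κ m P →
    let c = + 1 + + 2 * γ ; y = + 1 + + 2 * κ ; y′ = y + + 4 * P * m in
    c * (y′ * y′) ≡ (c * (y * y) + + 8 * P * m)
                    + + 8 * (+ 2 * P) * (m * (γ + κ + + 2 * γ * κ) + P * m * m * c)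
  corrected = solve-∀

twice-odd-square-lift : ∀ n {c r} → c ≡ + 2 ⟨mod + 4 ⟩ → r ≡ c ⟨mod + 16 ⟩ →
  ∃[ y ] y ≡ + 1 ⟨mod + 2 ⟩ × c * (y * y) ≡ r ⟨mod + 2 * (+ 8 * (+ 2) ℤ.^ n) ⟩
twice-odd-square-lift n (witness q refl) (witness p refl) =
  double (odd-square-lift n (witness q refl) (witness p refl))
  where
  c = + 2 + + 4 * q
  c′ = + 1 + + 2 * q
  c≡2c′ : ∀ q y → (+ 2 + + 4 * q) * (y * y) ≡ + 2 * ((+ 1 + + 2 * q) * (y * y))
  c≡2c′ = solve-∀
  2r′≡r : ∀ q p → + 2 * ((+ 1 + + 2 * q) + + 8 * p) ≡ (+ 2 + + 4 * q) + + 16 * p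
  2r′≡r = solve-∀
  double : (∃[ y ] y ≡ + 1 ⟨mod + 2 ⟩ × c′ * (y * y) ≡ c′ + + 8 * p ⟨mod + 8 * (+ 2) ℤ.^ n ⟩) →
           ∃[ y ] y ≡ + 1 ⟨mod + 2 ⟩ × c * (y * y) ≡ c + + 16 * p ⟨mod + 2 * (+ 8 * (+ 2) ℤ.^ n) ⟩
  double (y , y-odd , c′y²≡r′) = y , y-odd ,
    mod-trans (mod-reflexive (c≡2c′ q y))
              (mod-trans (mod-scale (+ 2) c′y²≡r′) (mod-reflexive (2r′≡r q p)))

Liftable : ℤ → ℤ → Set
Liftable c r = (c ≡ + 1 ⟨mod + 2 ⟩ × r ≡ c ⟨mod + 8 ⟩) ⊎ (c ≡ + 2 ⟨mod + 4 ⟩ × r ≡ c ⟨mod + 16 ⟩)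

liftable? : ∀ c r → Dec (Liftable c r)
liftable? c r = (c ≡? + 1 ⟨mod + 2 ⟩ ×-dec r ≡? c ⟨mod + 8 ⟩)
         ⊎-dec (c ≡? + 2 ⟨mod + 4 ⟩ ×-dec r ≡? c ⟨mod + 16 ⟩)

liftable-resp : ∀ {c c′ r r′} → c ≡ c′ ⟨mod + 16 ⟩ → r ≡ r′ ⟨mod + 16 ⟩ →
                Liftable c′ r′ → Liftable c r
liftable-resp c≡c′ r≡r′ (inj₁ (c′-odd , r′≡c′)) =
  inj₁ ( mod-resp (Signed.divides (+ 8) refl) c≡c′ mod-refl c′-odd
       , mod-resp (Signed.divides (+ 2) refl) r≡r′ c≡c′ r′≡c′)
liftable-resp c≡c′ r≡r′ (inj₂ (c′≡2 , r′≡c′)) =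
  inj₂ ( mod-resp (Signed.divides (+ 4) refl) c≡c′ mod-refl c′≡2
       , mod-resp (Signed.divides (+ 1) refl) r≡r′ c≡c′ r′≡c′)

liftable⇒odd-root : ∀ {c r} → Liftable c r →
                    ∃[ y ] y ≡ + 1 ⟨mod + 2 ⟩ × c * (y * y) ≡ r ⟨mod + 256 ⟩
liftable⇒odd-root (inj₁ (c-odd , r≡c)) = odd-square-lift 5 c-odd r≡c
liftable⇒odd-root (inj₂ (c≡2 , r≡c))   = twice-odd-square-lift 4 c≡2 r≡c

sum-cong-mod : ∀ {n m} {t t′ : Vector ℤ n} → (∀ i → t i ≡ t′ i ⟨mod m ⟩) →
               sum t ≡ sum t′ ⟨mod m ⟩
sum-cong-mod {zero}  _    = mod-refl
sum-cong-mod {suc n} t≡t′ = mod-+ (t≡t′ zero) (sum-cong-mod (t≡t′ ∘ suc))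

diagonalForm : ∀ {n} → Vector ℤ n → Vector ℤ n → ℤ
diagonalForm e x = sum λ i → e i * (x i * x i)

diagonalForm-cong-mod : ∀ {n m} {e e′ : Vector ℤ n} → (∀ i → e i ≡ e′ i ⟨mod m ⟩) →
                        ∀ x → diagonalForm e x ≡ diagonalForm e′ x ⟨mod m ⟩
diagonalForm-cong-mod e≡e′ x = sum-cong-mod λ i → mod-* (e≡e′ i) mod-refl

diagonalForm-insertAt : ∀ {n} (e : Vector ℤ (suc n)) x j y →
  diagonalForm e (insertAt x j y) ≡ e j * (y * y) + diagonalForm (removeAt e j) x
diagonalForm-insertAt e x j y = begin
  diagonalForm e x′
    ≡⟨ sum-remove {i = j} (λ i → e i * (x′ i * x′ i)) ⟩
  e j * (x′ j * x′ j) + sum (λ i → e (punchIn j i) * (x′ (punchIn j i) * x′ (punchIn j i)))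
    ≡⟨ cong₂ _+_ (cong (λ z → e j * (z * z)) (insertAt-lookup x j y))
                 (sum-cong-≗ λ i → cong (λ z → e (punchIn j i) * (z * z)) (insertAt-punchIn x j y i)) ⟩
  e j * (y * y) + diagonalForm (removeAt e j) x
    ∎
  where
  open ≡-Reasoning
  x′ = insertAt x j y

coefficients : ℤ → ℤ → Vector ℤ 4
coefficients a b 0F = + 1
coefficients a b 1F = - a
coefficients a b 2F = - b
coefficients a b 3F = - (a * b)

coefficients-cong-mod : ∀ {a a′ b b′ m} → a ≡ a′ ⟨mod m ⟩ → b ≡ b′ ⟨mod m ⟩ →
                        ∀ i → coefficients a b i ≡ coefficients a′ b′ i ⟨mod m ⟩
coefficients-cong-mod a≡a′ b≡b′ 0F = mod-refl
coefficients-cong-mod a≡a′ b≡b′ 1F = mod-neg a≡a′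
coefficients-cong-mod a≡a′ b≡b′ 2F = mod-neg b≡b′
coefficients-cong-mod a≡a′ b≡b′ 3F = mod-neg (mod-* a≡a′ b≡b′)

f-diagonal : ∀ a b (x : Vector ℤ 4) →
             f a b (x 0F) (x 1F) (x 2F) (x 3F) ≡ diagonalForm (coefficients a b) x
f-diagonal a b x = expand a b (x 0F) (x 1F) (x 2F) (x 3F)
  where
  -- the right-hand side is what diagonalForm unfolds to; the solver cannot see through sum
  expand : ∀ a b x₀ x₁ x₂ x₃ →
    x₀ * x₀ - a * (x₁ * x₁) - b * (x₂ * x₂) - (a * b) * (x₃ * x₃) ≡
    + 1 * (x₀ * x₀) + (- a * (x₁ * x₁) + (- b * (x₂ * x₂) + (- (a * b) * (x₃ * x₃) + + 0)))
  expand = solve-∀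

gcd4-∣ : ∀ (x : Vector ℤ 4) i → gcd4 (x 0F) (x 1F) (x 2F) (x 3F) ℕ.∣ ℤ.∣ x i ∣
gcd4-∣ x = divides
  where
  n : Fin 4 → ℕ
  n i = ℤ.∣ x i ∣
  g₂ = gcd (n 0F) (n 1F)
  g₃ = gcd g₂ (n 2F)
  g∣g₃ = gcd[m,n]∣m g₃ (n 3F)
  g∣g₂ = ℕ.∣-trans g∣g₃ (gcd[m,n]∣m g₂ (n 2F))
  divides : ∀ i → gcd g₃ (n 3F) ℕ.∣ n i
  divides 0F = ℕ.∣-trans g∣g₂ (gcd[m,n]∣m (n 0F) (n 1F))
  divides 1F = ℕ.∣-trans g∣g₂ (gcd[m,n]∣n (n 0F) (n 1F))
  divides 2F = ℕ.∣-trans g∣g₃ (gcd[m,n]∣n g₂ (n 2F))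
  divides 3F = gcd[m,n]∣n g₃ (n 3F)

odd⇒2∤∣∣ : ∀ {y} → y ≡ + 1 ⟨mod + 2 ⟩ → ¬ 2 ℕ.∣ ℤ.∣ y ∣
odd⇒2∤∣∣ (witness k refl) 2∣y = ℕ.>⇒∤ (ℕ.s≤s (ℕ.s≤s ℕ.z≤n)) (Signed.∣⇒∣ᵤ {+ 2} {+ 1}
  (Signed.∣m+n∣n⇒∣m (Signed.∣ᵤ⇒∣ {+ 2} {+ 1 + + 2 * k} 2∣y) (Signed.∣m⇒∣m*n k Signed.∣-refl)))

∣2∧∣odd⇒≡1 : ∀ {g n} → g ℕ.∣ 2 → g ℕ.∣ n → ¬ 2 ℕ.∣ n → g ≡ 1
∣2∧∣odd⇒≡1 g∣2 g∣n 2∤n with irreducible[2] g∣2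
... | inj₁ g≡1  = g≡1
... | inj₂ refl = ⊥-elim (2∤n g∣n)

ProperlyRepresents : ℤ → ℤ → ℤ → ℤ → Set
ProperlyRepresents a b d m =
  ∃[ r0 ] ∃[ r1 ] ∃[ r2 ] ∃[ r3 ] ((gcd4 r0 r1 r2 r3 ≡ 1) × f a b r0 r1 r2 r3 ≡ d ⟨mod m ⟩)

-- Coordinate j is reserved for an odd square root y; the other coordinates take the small
-- values s, one of which divides 2.
record Seed (a b d : ℤ) (j : Fin 4) (s : Vector ℕ 3) : Set where
  constructor seed
  field
    liftable : Liftable (coefficients a b j)
                        (d - diagonalForm (removeAt (coefficients a b) j) (+_ ∘ s))
    entry∣2  : ∃[ i ] s i ℕ.∣ 2

seed? : ∀ a b d j s → Dec (Seed a b d j s)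
seed? a b d j s = map′ (λ (l , e) → seed l e) (λ (seed l e) → l , e)
                       (liftable? _ _ ×-dec any? λ i → s i ℕ.∣? 2)

seed-resp : ∀ {a a′ b b′ d d′ j s} →
            a ≡ a′ ⟨mod + 16 ⟩ → b ≡ b′ ⟨mod + 16 ⟩ → d ≡ d′ ⟨mod + 16 ⟩ →
            Seed a′ b′ d′ j s → Seed a b d j s
seed-resp {j = j} {s} a≡a′ b≡b′ d≡d′ (seed liftable entry∣2) =
  seed (liftable-resp c≡c′ r≡r′ liftable) entry∣2
  where
  e≡e′ = coefficients-cong-mod a≡a′ b≡b′
  c≡c′ = e≡e′ j
  r≡r′ = mod-+ d≡d′ (mod-neg (diagonalForm-cong-mod (e≡e′ ∘ punchIn j) (+_ ∘ s)))

seed⇒properlyRepresents : ∀ {a b d j s} → Seed a b d j s → ProperlyRepresents a b d (+ 256)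
seed⇒properlyRepresents {a} {b} {d} {j} {s} (seed liftable (i , sᵢ∣2)) =
  represent (liftable⇒odd-root liftable)
  where
  e = coefficients a b
  t = +_ ∘ s
  R = diagonalForm (removeAt e j) t
  minus-plus : ∀ d R → (d - R) + R ≡ d
  minus-plus = solve-∀
  represent : (∃[ y ] y ≡ + 1 ⟨mod + 2 ⟩ × e j * (y * y) ≡ d - R ⟨mod + 256 ⟩) →
              ProperlyRepresents a b d (+ 256)
  represent (y , y-odd , ey²≡d-R) = x 0F , x 1F , x 2F , x 3F , g≡1 , fx≡d
    where
    x = insertAt t j y
    g = gcd4 (x 0F) (x 1F) (x 2F) (x 3F)
    g∣y : g ℕ.∣ ℤ.∣ y ∣
    g∣y = subst (λ z → g ℕ.∣ ℤ.∣ z ∣) (insertAt-lookup t j y) (gcd4-∣ x j)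
    g∣sᵢ : g ℕ.∣ s i
    g∣sᵢ = subst (λ z → g ℕ.∣ ℤ.∣ z ∣) (insertAt-punchIn t j y i) (gcd4-∣ x (punchIn j i))
    g≡1 : g ≡ 1
    g≡1 = ∣2∧∣odd⇒≡1 (ℕ.∣-trans g∣sᵢ sᵢ∣2) g∣y (odd⇒2∤∣∣ y-odd)
    fx≡d : f a b (x 0F) (x 1F) (x 2F) (x 3F) ≡ d ⟨mod + 256 ⟩
    fx≡d = mod-trans (mod-reflexive (trans (f-diagonal a b x) (diagonalForm-insertAt e t j y)))
                     (mod-trans (mod-+ ey²≡d-R (mod-refl {R})) (mod-reflexive (minus-plus d R)))

triple : Fin 3 → Fin 3 → Fin 3 → Vector ℕ 3
triple u v w 0F = toℕ u
triple u v w 1F = toℕ v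
triple u v w 2F = toℕ w

SeedTable : Set
SeedTable = ∀ (a b d : Fin 16) → let A = + toℕ a ; B = + toℕ b ; D = + toℕ d in
  ¬ A ≡ + 0 ⟨mod + 4 ⟩ → ¬ B ≡ + 0 ⟨mod + 4 ⟩ → ¬ D ≡ + 0 ⟨mod + 4 ⟩ →
  ∃[ j ] ∃[ u ] ∃[ v ] ∃[ w ] Seed A B D j (triple u v w)

seed-table : SeedTable
seed-table = toWitness {a? = decide} _
  where
  decide : Dec SeedTable
  decide = all? λ a → all? λ b → all? λ d → let A = + toℕ a ; B = + toℕ b ; D = + toℕ d in
    ¬? (A ≡? + 0 ⟨mod + 4 ⟩) →-dec ¬? (B ≡? + 0 ⟨mod + 4 ⟩) →-dec ¬? (D ≡? + 0 ⟨mod + 4 ⟩) →-dec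
    any? λ j → any? λ u → any? λ v → any? λ w → seed? A B D j (triple u v w)

≢0-resp : ∀ {x x′} → x ≡ x′ ⟨mod + 16 ⟩ → ¬ x ≡ + 0 ⟨mod + 4 ⟩ → ¬ x′ ≡ + 0 ⟨mod + 4 ⟩
≢0-resp x≡x′ x≢0 x′≡0 = x≢0 (mod-resp (Signed.divides (+ 4) refl) x≡x′ mod-refl x′≡0)

properlyRepresents-mod-256 : ∀ a b d →
  ¬ a ≡ + 0 ⟨mod + 4 ⟩ → ¬ b ≡ + 0 ⟨mod + 4 ⟩ → ¬ d ≡ + 0 ⟨mod + 4 ⟩ →
  ProperlyRepresents a b d (+ 256)
properlyRepresents-mod-256 a b d a≢0 b≢0 d≢0 =
  let a₀ , a≡a₀ = residue a 16
      b₀ , b≡b₀ = residue b 16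
      d₀ , d≡d₀ = residue d 16
      j , u , v , w , s₀ = seed-table a₀ b₀ d₀ (≢0-resp a≡a₀ a≢0) (≢0-resp b≡b₀ b≢0) (≢0-resp d≡d₀ d≢0)
  in seed⇒properlyRepresents (seed-resp a≡a₀ b≡b₀ d≡d₀ s₀)

properlyRepresents-weaken : ∀ a b d {m} n → ℤ.∣ n ∣ ℕ.∣ ℤ.∣ m ∣ → ProperlyRepresents a b d m →
  ∃[ r0 ] ∃[ r1 ] ∃[ r2 ] ∃[ r3 ] ((gcd4 r0 r1 r2 r3 ≡ 1) × (f a b r0 r1 r2 r3 ≡ d [mod n ]))
properlyRepresents-weaken a b d n n∣m (r0 , r1 , r2 , r3 , g≡1 , f≡d) =
  r0 , r1 , r2 , r3 , g≡1 , ℕ.∣-trans n∣m (⟨mod⟩⇒[mod] f≡d)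

2∤m∧2∤n⇒2∤m*n : ∀ {m n} → ¬ 2 ℕ.∣ m → ¬ 2 ℕ.∣ n → ¬ 2 ℕ.∣ m ℕ.* n
2∤m∧2∤n⇒2∤m*n {m} {n} 2∤m 2∤n 2∣mn = [ 2∤m , 2∤n ]′ (euclidsLemma m n prime[2] 2∣mn)

4∤⇒∣2*odd : ∀ {a} → ¬ 4 ℕ.∣ a → ∃[ u ] ¬ 2 ℕ.∣ u × a ℕ.∣ 2 ℕ.* u
4∤⇒∣2*odd {a} 4∤a with 2 ℕ.∣? a
... | no 2∤a                 = a , 2∤a , ℕ.n∣m*n 2
... | yes (ℕ.divides u refl) = u , (λ 2∣u → 4∤a (ℕ.*-monoˡ-∣ 2 2∣u)) , ℕ.∣-reflexive (ℕP.*-comm u 2)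

2^m∣2^n*o⇒2^m∣2^n : ∀ m n {o} → ¬ 2 ℕ.∣ o → 2 ^ m ℕ.∣ 2 ^ n ℕ.* o → 2 ^ m ℕ.∣ 2 ^ n
2^m∣2^n*o⇒2^m∣2^n zero    n           2∤o _ = ℕ.1∣ _
2^m∣2^n*o⇒2^m∣2^n (suc m) zero    {o} 2∤o 2^m∣o =
  ⊥-elim (2∤o (ℕ.∣-trans (ℕ.m∣m*n (2 ^ m)) (subst (2 ^ suc m ℕ.∣_) (ℕP.*-identityˡ o) 2^m∣o)))
2^m∣2^n*o⇒2^m∣2^n (suc m) (suc n) {o} 2∤o 2^m∣2^n*o = ℕ.*-monoʳ-∣ 2
  (2^m∣2^n*o⇒2^m∣2^n m n 2∤o
    (ℕ.*-cancelˡ-∣ 2 (subst (2 ^ suc m ℕ.∣_) (ℕP.*-assoc 2 (2 ^ n) o) 2^m∣2^n*o)))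

2^ν∣16a²b²⇒2^ν∣2⁸ : ∀ ν {a b} → ¬ 4 ℕ.∣ a → ¬ 4 ℕ.∣ b →
                     2 ^ ν ℕ.∣ 16 ℕ.* (a ℕ.* a) ℕ.* (b ℕ.* b) → 2 ^ ν ℕ.∣ 2 ^ 8
2^ν∣16a²b²⇒2^ν∣2⁸ ν {a} {b} 4∤a 4∤b 2^ν∣N with 4∤⇒∣2*odd 4∤a | 4∤⇒∣2*odd 4∤b
... | u , 2∤u , a∣2u | v , 2∤v , b∣2v =
  2^m∣2^n*o⇒2^m∣2^n ν 8 {w} (2∤m∧2∤n⇒2∤m*n 2∤uv 2∤uv) (ℕ.∣-trans 2^ν∣N N∣2⁸w)
  where
  w = (u ℕ.* v) ℕ.* (u ℕ.* v)
  2∤uv = 2∤m∧2∤n⇒2∤m*n 2∤u 2∤v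
  regroup : ∀ u v → 16 ℕ.* ((2 ℕ.* u) ℕ.* (2 ℕ.* u)) ℕ.* ((2 ℕ.* v) ℕ.* (2 ℕ.* v))
                    ≡ 256 ℕ.* ((u ℕ.* v) ℕ.* (u ℕ.* v))
  regroup = ℕ.solve-∀
  N∣2⁸w : 16 ℕ.* (a ℕ.* a) ℕ.* (b ℕ.* b) ℕ.∣ 256 ℕ.* w
  N∣2⁸w = ℕ.∣-trans (ℕ.*-pres-∣ (ℕ.*-monoʳ-∣ 16 (ℕ.*-pres-∣ a∣2u a∣2u)) (ℕ.*-pres-∣ b∣2v b∣2v))
                    (ℕ.∣-reflexive (regroup u v))

∤⇒≢0⟨mod⟩ : ∀ {m a} → ¬ m ℕ.∣ a → ¬ + a ≡ + 0 ⟨mod + m ⟩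
∤⇒≢0⟨mod⟩ {m} {a} m∤a a≡0 = m∤a (subst (m ℕ.∣_) (ℕP.+-identityʳ a) (⟨mod⟩⇒[mod] a≡0))

lemma3p3 : (a b : ℕ) → 1 ℕ.≤ a → 1 ℕ.≤ b → SquareFree a → SquareFree b →
    gcd a b ≤ 2 → (ν : ℕ) → ExactTwoPower ν (16 ℕ.* (a ℕ.* a) ℕ.* (b ℕ.* b)) →
    (d : ℤ) → ¬ (d ≡ (+ 0) [mod (+ 4) ]) →
    ∃[ r0 ] ∃[ r1 ] ∃[ r2 ] ∃[ r3 ]
      ((gcd4 r0 r1 r2 r3 ≡ 1) ×
       (f (+ a) (+ b) r0 r1 r2 r3 ≡ d [mod (+ (2 ^ ν)) ]))
lemma3p3 a b _ _ a-squarefree b-squarefree _ ν (2^ν∣N , _) d d≢0 =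
  properlyRepresents-weaken (+ a) (+ b) d (+ (2 ^ ν)) (2^ν∣16a²b²⇒2^ν∣2⁸ ν 4∤a 4∤b 2^ν∣N)
    (properlyRepresents-mod-256 (+ a) (+ b) d (∤⇒≢0⟨mod⟩ 4∤a) (∤⇒≢0⟨mod⟩ 4∤b) (d≢0 ∘ ⟨mod⟩⇒[mod]))
  where
  4∤a = a-squarefree 2 prime[2]
  4∤b = b-squarefree 2 prime[2]
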